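{- Let $n$ be a positive integer and let $G=(U,V,E)$ be a bipartite graph with $U=\{u_1,\dots,u_n\}$, $V=\{v_1,\dots,v_n\}$ and $E\subseteq U\times V$. For every integer $k$ with $n\ge k>\frac{n}{2}$, $$\sum_{1\le i,j\le n}\mathbf{1}\Big\{|\deg(u_i)-\deg(v_j)|\ge k\Big\}\le 2k(n-k).$$
   Context: $\deg(w)$ denotes the degree of vertex $w$ in $G$, and $\mathbf{1}\{\cdot\}$ is the indicator of the event in braces. -}

module Defs where

open import Data.Nat using (ℕ; zero; suc; _+_; _≥_; _≥?_)
open import Data.Fin using (Fin; zero; suc)
open import Data.Bool using (Bool; true; false)
open import Relation.Nullary using (Dec; yes; no)

sumFin : (n : ℕ) → (Fin n → ℕ) → ℕ
sumFin zero    f = 0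
sumFin (suc n) f = f zero + sumFin n (λ i → f (suc i))

𝟙 : Bool → ℕ
𝟙 true  = 1
𝟙 false = 0

-- A bipartite graph with parts U = {u_0..u_{n-1}}, V = {v_0..v_{n-1}}
-- is given by its adjacency relation E : Fin n → Fin n → Bool,
-- where E i j = true iff (u_i , v_j) ∈ E.
BipGraph : ℕ → Set
BipGraph n = Fin n → Fin n → Bool

degU : ∀ {n} → BipGraph n → Fin n → ℕ
degU {n} E i = sumFin n (λ j → 𝟙 (E i j))

degV : ∀ {n} → BipGraph n → Fin n → ℕ
degV {n} E j = sumFin n (λ i → 𝟙 (E i j))

[_] : ∀ {P : Set} → Dec P → ℕ
[ yes _ ] = 1
[ no  _ ] = 0

-- Put m = n − k < k. If deg u_i ≥ deg v_j + k then u_i is high (degree ≥ k) and v_j is low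
-- (degree ≤ m); with P high and Q low vertices, the number T of such pairs is at most PQ.
-- For high u_i and low v_j, the non-degree n − deg u_i plus deg v_j is at most 2m, and at
-- most m when the pair is one of the T. Every high–low pair is a non-edge at u_i or an edge
-- at v_j, so these weights summed over all high–low pairs are at least min(P,Q)·PQ. Hence
-- min(P,Q)·PQ + mT ≤ 2m·PQ, which AM–GM turns into T ≤ m·max(P,Q). Pairs with
-- deg v_j ≥ deg u_i + k obey the same bound with the sides exchanged, and since no vertex is
-- both high and low, the two bounds add up to at most 2km.

module Submission where

open import Defs
open import Data.Nat using (ℕ; _*_; _∸_; _≤_; _<_; _≥?_; ∣_-_∣)
open import Data.Nat using (zero; suc; _+_; _⊓_; _≥_; z≤n; s≤s)
open import Data.Nat.Properties
open import Data.Nat.Tactic.RingSolver using (solve-∀)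
open import Data.Fin using (Fin; zero; suc)
open import Data.Bool using (true; false; not)
open import Data.Product using (_×_; _,_; proj₁; proj₂)
open import Data.Sum using (_⊎_; inj₁; inj₂; swap)
open import Data.Empty using (⊥; ⊥-elim)
open import Function using (_∘_; flip)
open import Relation.Nullary using (Dec; yes; no)
open import Relation.Binary.PropositionalEquality
  using (_≡_; _≗_; refl; sym; trans; cong; cong₂; subst; subst₂; module ≡-Reasoning)
open import Algebra.Properties.Semiring.Sum +-*-semiring
  using (sum; sum-cong-≗; ∑-distrib-+; ∑-comm; *-distribˡ-sum; *-distribʳ-sum)

sumFin≡sum : ∀ n (f : Fin n → ℕ) → sumFin n f ≡ sum f
sumFin≡sum zero    f = refl
sumFin≡sum (suc n) f = cong (f zero +_) (sumFin≡sum n (f ∘ suc))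

sumFin-cong : ∀ n {f g : Fin n → ℕ} → f ≗ g → sumFin n f ≡ sumFin n g
sumFin-cong n {f} {g} f≗g rewrite sumFin≡sum n f | sumFin≡sum n g = sum-cong-≗ f≗g

sumFin-distrib-+ : ∀ n (f g : Fin n → ℕ) →
  sumFin n (λ i → f i + g i) ≡ sumFin n f + sumFin n g
sumFin-distrib-+ n f g
  rewrite sumFin≡sum n (λ i → f i + g i) | sumFin≡sum n f | sumFin≡sum n g = ∑-distrib-+ f g

*-distribˡ-sumFin : ∀ n c (f : Fin n → ℕ) → sumFin n (λ i → c * f i) ≡ c * sumFin n f
*-distribˡ-sumFin n c f
  rewrite sumFin≡sum n (λ i → c * f i) | sumFin≡sum n f = sym (*-distribˡ-sum c f)

*-distribʳ-sumFin : ∀ n c (f : Fin n → ℕ) → sumFin n (λ i → f i * c) ≡ sumFin n f * c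
*-distribʳ-sumFin n c f
  rewrite sumFin≡sum n (λ i → f i * c) | sumFin≡sum n f = sym (*-distribʳ-sum c f)

sumFin-comm : ∀ n p (f : Fin n → Fin p → ℕ) →
  sumFin n (λ i → sumFin p (f i)) ≡ sumFin p (λ j → sumFin n (λ i → f i j))
sumFin-comm n p f = begin
  sumFin n (λ i → sumFin p (f i))         ≡⟨ sumFin-cong n (λ i → sumFin≡sum p (f i)) ⟩
  sumFin n (λ i → sum (f i))              ≡⟨ sumFin≡sum n _ ⟩
  sum (λ i → sum (f i))                   ≡⟨ ∑-comm f ⟩
  sum (λ j → sum (λ i → f i j))           ≡⟨ sumFin≡sum p _ ⟨
  sumFin p (λ j → sum (λ i → f i j))      ≡⟨ sumFin-cong p (λ j → sumFin≡sum n (λ i → f i j)) ⟨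
  sumFin p (λ j → sumFin n (λ i → f i j)) ∎
  where open ≡-Reasoning

sumFin-mono-≤ : ∀ n {f g : Fin n → ℕ} → (∀ i → f i ≤ g i) → sumFin n f ≤ sumFin n g
sumFin-mono-≤ zero    f≤g = z≤n
sumFin-mono-≤ (suc n) f≤g = +-mono-≤ (f≤g zero) (sumFin-mono-≤ n (f≤g ∘ suc))

sumFin-1 : ∀ n → sumFin n (λ _ → 1) ≡ n
sumFin-1 zero    = refl
sumFin-1 (suc n) = cong suc (sumFin-1 n)

sumFin²-distrib-+ : ∀ n p (f g : Fin n → Fin p → ℕ) →
  sumFin n (λ i → sumFin p (λ j → f i j + g i j)) ≡
  sumFin n (λ i → sumFin p (f i)) + sumFin n (λ i → sumFin p (g i))
sumFin²-distrib-+ n p f g =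
  trans (sumFin-cong n (λ i → sumFin-distrib-+ p (f i) (g i))) (sumFin-distrib-+ n _ _)

*-distribˡ-sumFin² : ∀ n p c (f : Fin n → Fin p → ℕ) →
  sumFin n (λ i → sumFin p (λ j → c * f i j)) ≡ c * sumFin n (λ i → sumFin p (f i))
*-distribˡ-sumFin² n p c f =
  trans (sumFin-cong n (λ i → *-distribˡ-sumFin p c (f i))) (*-distribˡ-sumFin n c _)

indicator-≤-1 : ∀ {P : Set} (p : Dec P) → [ p ] ≤ 1
indicator-≤-1 (yes _) = ≤-refl
indicator-≤-1 (no _)  = z≤n

indicator-≤-* : ∀ {P Q R : Set} (p : Dec P) (q : Dec Q) (r : Dec R) →
  (P → Q × R) → [ p ] ≤ [ q ] * [ r ]
indicator-≤-* (no _)  _       _       _    = z≤n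
indicator-≤-* (yes _) (yes _) (yes _) _    = ≤-refl
indicator-≤-* (yes x) (no ¬y) _       P⇒QR = ⊥-elim (¬y (proj₁ (P⇒QR x)))
indicator-≤-* (yes x) (yes _) (no ¬z) P⇒QR = ⊥-elim (¬z (proj₂ (P⇒QR x)))

indicator-≤-+ : ∀ {P Q R : Set} (p : Dec P) (q : Dec Q) (r : Dec R) →
  (P → Q ⊎ R) → [ p ] ≤ [ q ] + [ r ]
indicator-≤-+ (no _)  _       _       _    = z≤n
indicator-≤-+ (yes _) (yes _) _       _    = s≤s z≤n
indicator-≤-+ (yes _) (no _)  (yes _) _    = ≤-refl
indicator-≤-+ (yes x) (no ¬y) (no ¬z) P⇒Q⊎R with P⇒Q⊎R x
... | inj₁ y = ⊥-elim (¬y y)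
... | inj₂ z = ⊥-elim (¬z z)

indicator-+-≤-1 : ∀ {Q R : Set} (q : Dec Q) (r : Dec R) → (Q → R → ⊥) → [ q ] + [ r ] ≤ 1
indicator-+-≤-1 (yes y) (yes z) disjoint = ⊥-elim (disjoint y z)
indicator-+-≤-1 (yes _) (no _)  _        = ≤-refl
indicator-+-≤-1 (no _)  (yes _) _        = ≤-refl
indicator-+-≤-1 (no _)  (no _)  _        = z≤n

rearrangement-≤ : ∀ {a b c d} → a ≤ c → b ≤ d → a * d + c * b ≤ a * b + c * d
rearrangement-≤ {a} {b} a≤c b≤d with m≤n⇒∃[o]m+o≡n a≤c | m≤n⇒∃[o]m+o≡n b≤d
... | x , refl | y , refl =
  subst (a * (b + y) + (a + x) * b ≤_) (identity a b x y) (m≤m+n _ (x * y))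
  where
  identity : ∀ a b x y → a * (b + y) + (a + x) * b + x * y ≡ a * b + (a + x) * (b + y)
  identity = solve-∀

2*m*n≤m*m+n*n : ∀ m n → 2 * m * n ≤ m * m + n * n
2*m*n≤m*m+n*n m n with ≤-total m n
... | inj₁ m≤n = subst₂ _≤_ (identity m n) refl (rearrangement-≤ m≤n m≤n)
  where
  identity : ∀ m n → m * n + n * m ≡ 2 * m * n
  identity = solve-∀
... | inj₂ n≤m = subst₂ _≤_ (identity m n) (+-comm (n * n) (m * m)) (rearrangement-≤ n≤m n≤m)
  where
  identity : ∀ m n → n * m + m * n ≡ 2 * m * n
  identity = solve-∀

-- mT ≤ 2mxX − x²X ≤ m²X by AM–GM; for m = 0 the hypothesis forces xX = 0 instead.
quadratic-cancel-≤ : ∀ x X m T → x * (x * X) + m * T ≤ 2 * m * (x * X) → T ≤ x * X → T ≤ m * X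
quadratic-cancel-≤ x X zero T x²X≤0 T≤xX with m*n≡0⇒m≡0∨n≡0 x (n≤0⇒n≡0 (m+n≤o⇒m≤o _ x²X≤0))
... | inj₁ refl = T≤xX
... | inj₂ xX≡0 = subst (T ≤_) xX≡0 T≤xX
quadratic-cancel-≤ x X m@(suc _) T ineq _ = *-cancelˡ-≤ m (+-cancelʳ-≤ (x * (x * X)) _ _ (begin
  m * T + x * (x * X)        ≡⟨ +-comm (m * T) _ ⟩
  x * (x * X) + m * T        ≤⟨ ineq ⟩
  2 * m * (x * X)            ≡⟨ *-assoc (2 * m) x X ⟨
  2 * m * x * X              ≤⟨ *-monoˡ-≤ X (2*m*n≤m*m+n*n m x) ⟩
  (m * m + x * x) * X        ≡⟨ identity m x X ⟩
  m * (m * X) + x * (x * X)  ∎))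
  where
  open ≤-Reasoning
  identity : ∀ m x X → (m * m + x * x) * X ≡ m * (m * X) + x * (x * X)
  identity = solve-∀

*-⊓-≤ : ∀ {m p q T} → T ≤ m * p → T ≤ p * q → T ≤ p * (m ⊓ q)
*-⊓-≤ {m} {p} {q} {T} T≤mp T≤pq =
  subst (T ≤_) (sym (*-distribˡ-⊓ p m q)) (⊓-glb (subst (T ≤_) (*-comm m p) T≤mp) T≤pq)

capped-products-≤ : ∀ {k m x₁ x₂ s₁ s₂} → m ≤ k → x₁ + x₂ ≤ k + m → s₁ ≤ m → s₂ ≤ m →
  x₁ * s₁ + x₂ * s₂ ≤ 2 * k * m
capped-products-≤ {k} {m} {x₁} {x₂} {s₁} {s₂} m≤k x₁+x₂≤k+m s₁≤m s₂≤m = begin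
  x₁ * s₁ + x₂ * s₂  ≤⟨ +-mono-≤ (*-monoʳ-≤ x₁ s₁≤m) (*-monoʳ-≤ x₂ s₂≤m) ⟩
  x₁ * m + x₂ * m    ≡⟨ *-distribʳ-+ m x₁ x₂ ⟨
  (x₁ + x₂) * m      ≤⟨ *-monoˡ-≤ m x₁+x₂≤k+m ⟩
  (k + m) * m        ≤⟨ *-monoˡ-≤ m (+-monoʳ-≤ k m≤k) ⟩
  (k + k) * m        ≡⟨ identity k m ⟩
  2 * k * m          ∎
  where
  open ≤-Reasoning
  identity : ∀ k m → (k + k) * m ≡ 2 * k * m
  identity = solve-∀

-- Adding 2 s₁ s₂ to both sides, the bound follows from two instances of the rearrangement
-- inequality with s₁, s₂ ≤ m ≤ k.
crossed-products-≤ : ∀ {k m x₁ x₂ s₁ s₂} → m ≤ k → x₁ + s₂ ≤ k + m → s₁ + x₂ ≤ k + m →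
  s₁ ≤ m → s₂ ≤ m → x₁ * s₁ + x₂ * s₂ ≤ 2 * k * m
crossed-products-≤ {k} {m} {x₁} {x₂} {s₁} {s₂} m≤k x₁+s₂≤k+m s₁+x₂≤k+m s₁≤m s₂≤m =
  +-cancelʳ-≤ (s₁ * s₂ + s₂ * s₁) _ _ (begin
    x₁ * s₁ + x₂ * s₂ + (s₁ * s₂ + s₂ * s₁)       ≡⟨ identity₁ x₁ x₂ s₁ s₂ ⟩
    (x₁ + s₂) * s₁ + (s₁ + x₂) * s₂               ≤⟨ +-mono-≤ (*-monoˡ-≤ s₁ x₁+s₂≤k+m)
                                                               (*-monoˡ-≤ s₂ s₁+x₂≤k+m) ⟩
    (k + m) * s₁ + (k + m) * s₂                   ≡⟨ identity₂ k m s₁ s₂ ⟩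
    (s₁ * m + k * s₂) + (s₂ * m + k * s₁)         ≤⟨ +-mono-≤ (rearrangement-≤ (≤-trans s₁≤m m≤k) s₂≤m)
                                                               (rearrangement-≤ (≤-trans s₂≤m m≤k) s₁≤m) ⟩
    (s₁ * s₂ + k * m) + (s₂ * s₁ + k * m)         ≡⟨ identity₃ k m s₁ s₂ ⟩
    2 * k * m + (s₁ * s₂ + s₂ * s₁)               ∎)
  where
  open ≤-Reasoning
  identity₁ : ∀ x₁ x₂ s₁ s₂ →
    x₁ * s₁ + x₂ * s₂ + (s₁ * s₂ + s₂ * s₁) ≡ (x₁ + s₂) * s₁ + (s₁ + x₂) * s₂
  identity₁ = solve-∀
  identity₂ : ∀ k m s₁ s₂ → (k + m) * s₁ + (k + m) * s₂ ≡ (s₁ * m + k * s₂) + (s₂ * m + k * s₁)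
  identity₂ = solve-∀
  identity₃ : ∀ k m s₁ s₂ → (s₁ * s₂ + k * m) + (s₂ * s₁ + k * m) ≡ 2 * k * m + (s₁ * s₂ + s₂ * s₁)
  identity₃ = solve-∀

excess-pairs-≤ˡ : ∀ {k m T₁ T₂ P₁ Q₁ P₂ Q₂} → m ≤ k → P₁ + Q₂ ≤ k + m → Q₁ + P₂ ≤ k + m →
  T₁ ≤ P₁ * (m ⊓ Q₁) → T₂ ≤ P₂ * (m ⊓ Q₂) ⊎ T₂ ≤ Q₂ * (m ⊓ P₂) →
  T₁ + T₂ ≤ 2 * k * m
excess-pairs-≤ˡ {m = m} {P₁ = P₁} {Q₁} {P₂} {Q₂} m≤k P₁+Q₂≤ Q₁+P₂≤ T₁≤ (inj₁ T₂≤) =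
  ≤-trans (+-mono-≤ T₁≤ T₂≤) (crossed-products-≤ m≤k
    (≤-trans (+-monoʳ-≤ P₁ (m⊓n≤n m Q₂)) P₁+Q₂≤)
    (≤-trans (+-monoˡ-≤ P₂ (m⊓n≤n m Q₁)) Q₁+P₂≤)
    (m⊓n≤m m Q₁) (m⊓n≤m m Q₂))
excess-pairs-≤ˡ {m = m} {P₁ = P₁} {Q₁} {P₂} {Q₂} m≤k P₁+Q₂≤ _ T₁≤ (inj₂ T₂≤) =
  ≤-trans (+-mono-≤ T₁≤ T₂≤)
    (capped-products-≤ {x₁ = P₁} {Q₂} m≤k P₁+Q₂≤ (m⊓n≤m m Q₁) (m⊓n≤m m P₂))

excess-pairs-≤ : ∀ {k m T₁ T₂ P₁ Q₁ P₂ Q₂} → m ≤ k → P₁ + Q₂ ≤ k + m → Q₁ + P₂ ≤ k + m →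
  T₁ ≤ P₁ * (m ⊓ Q₁) ⊎ T₁ ≤ Q₁ * (m ⊓ P₁) →
  T₂ ≤ P₂ * (m ⊓ Q₂) ⊎ T₂ ≤ Q₂ * (m ⊓ P₂) →
  T₁ + T₂ ≤ 2 * k * m
excess-pairs-≤ {P₁ = P₁} {Q₁} {P₂} {Q₂} m≤k P₁+Q₂≤ Q₁+P₂≤ (inj₁ T₁≤) T₂≤ =
  excess-pairs-≤ˡ {P₁ = P₁} {Q₁} {P₂} {Q₂} m≤k P₁+Q₂≤ Q₁+P₂≤ T₁≤ T₂≤
excess-pairs-≤ {P₁ = P₁} {Q₁} {P₂} {Q₂} m≤k P₁+Q₂≤ Q₁+P₂≤ (inj₂ T₁≤) T₂≤ =
  excess-pairs-≤ˡ {P₁ = Q₁} {P₁} {Q₂} {P₂} m≤k Q₁+P₂≤ P₁+Q₂≤ T₁≤ (swap T₂≤)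

∣-∣≥⇒ : ∀ {k a b} → ∣ a - b ∣ ≥ k → a ≥ b + k ⊎ b ≥ a + k
∣-∣≥⇒ {k} {a} {b} k≤∣a-b∣ with ≤-total a b
... | inj₁ a≤b = inj₂ (subst (a + k ≤_) (m+[n∸m]≡n a≤b)
                        (+-monoʳ-≤ a (subst (k ≤_) (m≤n⇒∣m-n∣≡n∸m a≤b) k≤∣a-b∣)))
... | inj₂ b≤a = inj₁ (subst (b + k ≤_) (m+[n∸m]≡n b≤a)
                        (+-monoʳ-≤ b (subst (k ≤_) (m≤n⇒∣n-m∣≡n∸m b≤a) k≤∣a-b∣)))

high+low-≤ : ∀ {k m} n (d : Fin n → ℕ) → m < k →
  sumFin n (λ i → [ d i ≥? k ]) + sumFin n (λ i → [ m ≥? d i ]) ≤ n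
high+low-≤ n d m<k = begin
  sumFin n (λ i → [ d i ≥? _ ]) + sumFin n (λ i → [ _ ≥? d i ])  ≡⟨ sumFin-distrib-+ n _ _ ⟨
  sumFin n (λ i → [ d i ≥? _ ] + [ _ ≥? d i ])                  ≤⟨ sumFin-mono-≤ n (λ i →
      indicator-+-≤-1 (d i ≥? _) (_ ≥? d i) (λ k≤d d≤m → <⇒≱ m<k (≤-trans k≤d d≤m))) ⟩
  sumFin n (λ _ → 1)                                            ≡⟨ sumFin-1 n ⟩
  n                                                             ∎
  where open ≤-Reasoning

far⇒high×low : ∀ {k m a α b} → a + α ≡ k + m → a ≥ b + k → a ≥ k × m ≥ b
far⇒high×low {k} {m} {a} {α} {b} a+α≡k+m b+k≤a =
  ≤-trans (m≤n+m k b) b+k≤a ,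
  +-cancelʳ-≤ k b m (begin
    b + k   ≤⟨ b+k≤a ⟩
    a       ≤⟨ m≤m+n a α ⟩
    a + α   ≡⟨ a+α≡k+m ⟩
    k + m   ≡⟨ +-comm k m ⟩
    m + k   ∎)
  where open ≤-Reasoning

pair-weight-≤ : ∀ {k m a α b} → a + α ≡ k + m → a ≥ k → m ≥ b →
  α + b + m * [ a ≥? b + k ] ≤ 2 * m
pair-weight-≤ {k} {m} {a} {α} {b} a+α≡k+m k≤a b≤m with a ≥? b + k
... | yes b+k≤a = begin
  α + b + m * 1  ≤⟨ +-monoˡ-≤ (m * 1) α+b≤m ⟩
  m + m * 1      ≡⟨ identity m ⟩
  2 * m          ∎
  where
  open ≤-Reasoning
  identity : ∀ m → m + m * 1 ≡ 2 * m
  identity = solve-∀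
  α+b≤m : α + b ≤ m
  α+b≤m = +-cancelʳ-≤ k (α + b) m (begin
    α + b + k    ≡⟨ +-assoc α b k ⟩
    α + (b + k)  ≤⟨ +-monoʳ-≤ α b+k≤a ⟩
    α + a        ≡⟨ trans (+-comm α a) a+α≡k+m ⟩
    k + m        ≡⟨ +-comm k m ⟩
    m + k        ∎)
... | no _ = begin
  α + b + m * 0  ≤⟨ +-monoˡ-≤ (m * 0) (+-mono-≤ α≤m b≤m) ⟩
  m + m + m * 0  ≡⟨ identity m ⟩
  2 * m          ∎
  where
  open ≤-Reasoning
  identity : ∀ m → m + m + m * 0 ≡ 2 * m
  identity = solve-∀
  α≤m : α ≤ m
  α≤m = +-cancelʳ-≤ k α m (begin
    α + k  ≤⟨ +-monoʳ-≤ α k≤a ⟩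
    α + a  ≡⟨ trans (+-comm α a) a+α≡k+m ⟩
    k + m  ≡⟨ +-comm k m ⟩
    m + k  ∎)

weighted-pair-≤ : ∀ {k m a α b} → a + α ≡ k + m →
  [ a ≥? k ] * [ m ≥? b ] * (α + b) + m * [ a ≥? b + k ] ≤ 2 * m * ([ a ≥? k ] * [ m ≥? b ])
weighted-pair-≤ {k} {m} {a} {α} {b} a+α≡k+m with a ≥? k | m ≥? b
... | yes k≤a | yes b≤m =
  subst₂ _≤_ (cong (_+ m * [ a ≥? b + k ]) (sym (*-identityˡ (α + b)))) (sym (*-identityʳ (2 * m)))
    (pair-weight-≤ a+α≡k+m k≤a b≤m)
... | high@(no _) | low =
  *-mono-≤ (m≤m+n m _) (indicator-≤-* (a ≥? b + k) high low (far⇒high×low a+α≡k+m))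
... | high@(yes _) | low@(no _) =
  *-mono-≤ (m≤m+n m _) (indicator-≤-* (a ≥? b + k) high low (far⇒high×low a+α≡k+m))

*-≤-nonedge+edge : ∀ {h l} e → h ≤ 1 → l ≤ 1 → h * l ≤ h * 𝟙 (not e) + l * 𝟙 e
*-≤-nonedge+edge {h} {l} true h≤1 _ = begin
  h * l          ≤⟨ *-monoˡ-≤ l h≤1 ⟩
  1 * l          ≡⟨ *-identityˡ l ⟩
  l              ≡⟨ *-identityʳ l ⟨
  l * 1          ≡⟨ cong (_+ l * 1) (*-zeroʳ h) ⟨
  h * 0 + l * 1  ∎
  where open ≤-Reasoning
*-≤-nonedge+edge {h} {l} false _ l≤1 = begin
  h * l          ≤⟨ *-monoʳ-≤ h l≤1 ⟩
  h * 1          ≡⟨ +-identityʳ (h * 1) ⟨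
  h * 1 + 0      ≡⟨ cong (h * 1 +_) (*-zeroʳ l) ⟨
  h * 1 + l * 0  ∎
  where open ≤-Reasoning

module LeftExcess {n} (E : BipGraph n) (k m : ℕ) (k+m≡n : k + m ≡ n) where

  nondegU : Fin n → ℕ
  nondegU i = sumFin n (λ j → 𝟙 (not (E i j)))

  high : Fin n → ℕ
  high i = [ degU E i ≥? k ]

  low : Fin n → ℕ
  low j = [ m ≥? degV E j ]

  far : Fin n → Fin n → ℕ
  far i j = [ degU E i ≥? degV E j + k ]

  P Q T A B : ℕ
  P = sumFin n high
  Q = sumFin n low
  T = sumFin n (λ i → sumFin n (far i))
  A = sumFin n (λ i → high i * nondegU i)
  B = sumFin n (λ j → low j * degV E j)

  degU+nondegU≡k+m : ∀ i → degU E i + nondegU i ≡ k + m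
  degU+nondegU≡k+m i = begin
    degU E i + nondegU i                            ≡⟨ sumFin-distrib-+ n _ _ ⟨
    sumFin n (λ j → 𝟙 (E i j) + 𝟙 (not (E i j)))   ≡⟨ sumFin-cong n (λ j → 𝟙+𝟙-not (E i j)) ⟩
    sumFin n (λ _ → 1)                              ≡⟨ trans (sumFin-1 n) (sym k+m≡n) ⟩
    k + m                                           ∎
    where
    open ≡-Reasoning
    𝟙+𝟙-not : ∀ e → 𝟙 e + 𝟙 (not e) ≡ 1
    𝟙+𝟙-not true  = refl
    𝟙+𝟙-not false = refl

  sumFin-high*low : sumFin n (λ i → sumFin n (λ j → high i * low j)) ≡ P * Q
  sumFin-high*low =
    trans (sumFin-cong n (λ i → *-distribˡ-sumFin n (high i) low)) (*-distribʳ-sumFin n Q high)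

  T≤P*Q : T ≤ P * Q
  T≤P*Q = ≤-trans
    (sumFin-mono-≤ n (λ i → sumFin-mono-≤ n (λ j →
      indicator-≤-* (degU E i ≥? degV E j + k) (degU E i ≥? k) (m ≥? degV E j)
        (far⇒high×low (degU+nondegU≡k+m i)))))
    (≤-reflexive sumFin-high*low)

  P*Q≤A+B : P * Q ≤ A + B
  P*Q≤A+B = begin
    P * Q
      ≡⟨ sumFin-high*low ⟨
    sumFin n (λ i → sumFin n (λ j → high i * low j))
      ≤⟨ sumFin-mono-≤ n (λ i → sumFin-mono-≤ n (λ j →
           *-≤-nonedge+edge (E i j) (indicator-≤-1 (degU E i ≥? k))
                                     (indicator-≤-1 (m ≥? degV E j)))) ⟩
    sumFin n (λ i → sumFin n (λ j → high i * 𝟙 (not (E i j)) + low j * 𝟙 (E i j)))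
      ≡⟨ sumFin²-distrib-+ n n _ _ ⟩
    sumFin n (λ i → sumFin n (λ j → high i * 𝟙 (not (E i j))))
      + sumFin n (λ i → sumFin n (λ j → low j * 𝟙 (E i j)))
      ≡⟨ cong₂ _+_ (sumFin-cong n (λ i → *-distribˡ-sumFin n (high i) _))
                   (trans (sumFin-comm n n _)
                          (sumFin-cong n (λ j → *-distribˡ-sumFin n (low j) _))) ⟩
    A + B
      ∎
    where open ≤-Reasoning

  sumFin-weights : sumFin n (λ i → sumFin n (λ j → high i * low j * (nondegU i + degV E j)))
                   ≡ A * Q + P * B
  sumFin-weights = begin
    sumFin n (λ i → sumFin n (λ j → high i * low j * (nondegU i + degV E j)))
      ≡⟨ sumFin-cong n (λ i → sumFin-cong n (λ j →
           identity (high i) (low j) (nondegU i) (degV E j))) ⟩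
    sumFin n (λ i → sumFin n (λ j → high i * nondegU i * low j + high i * (low j * degV E j)))
      ≡⟨ sumFin-cong n (λ i → trans (sumFin-distrib-+ n _ _)
           (cong₂ _+_ (*-distribˡ-sumFin n (high i * nondegU i) low)
                      (*-distribˡ-sumFin n (high i) (λ j → low j * degV E j)))) ⟩
    sumFin n (λ i → high i * nondegU i * Q + high i * B)
      ≡⟨ trans (sumFin-distrib-+ n _ _)
           (cong₂ _+_ (*-distribʳ-sumFin n Q _) (*-distribʳ-sumFin n B high)) ⟩
    A * Q + P * B
      ∎
    where
    open ≡-Reasoning
    identity : ∀ h l α b → h * l * (α + b) ≡ h * α * l + h * (l * b)
    identity = solve-∀

  weighted-≤ : A * Q + P * B + m * T ≤ 2 * m * (P * Q)
  weighted-≤ = begin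
    A * Q + P * B + m * T
      ≡⟨ cong₂ _+_ sumFin-weights (*-distribˡ-sumFin² n n m far) ⟨
    sumFin n (λ i → sumFin n (λ j → high i * low j * (nondegU i + degV E j)))
      + sumFin n (λ i → sumFin n (λ j → m * far i j))
      ≡⟨ sumFin²-distrib-+ n n _ _ ⟨
    sumFin n (λ i → sumFin n (λ j → high i * low j * (nondegU i + degV E j) + m * far i j))
      ≤⟨ sumFin-mono-≤ n (λ i → sumFin-mono-≤ n (λ j →
           weighted-pair-≤ {k} {m} {b = degV E j} (degU+nondegU≡k+m i))) ⟩
    sumFin n (λ i → sumFin n (λ j → 2 * m * (high i * low j)))
      ≡⟨ *-distribˡ-sumFin² n n (2 * m) _ ⟩
    2 * m * sumFin n (λ i → sumFin n (λ j → high i * low j))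
      ≡⟨ cong (2 * m *_) sumFin-high*low ⟩
    2 * m * (P * Q)
      ∎
    where open ≤-Reasoning

  T≤m*X : ∀ {x X} → x * X ≡ P * Q → x ≤ P → x ≤ Q → T ≤ m * X
  T≤m*X {x} {X} x*X≡P*Q x≤P x≤Q = quadratic-cancel-≤ x X m T
    (begin
      x * (x * X) + m * T    ≡⟨ cong (λ y → x * y + m * T) x*X≡P*Q ⟩
      x * (P * Q) + m * T    ≤⟨ +-monoˡ-≤ (m * T) (*-monoʳ-≤ x P*Q≤A+B) ⟩
      x * (A + B) + m * T    ≡⟨ cong (_+ m * T) (*-distribˡ-+ x A B) ⟩
      x * A + x * B + m * T  ≤⟨ +-monoˡ-≤ (m * T) (+-mono-≤ (≤-trans (≤-reflexive (*-comm x A))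
                                                                   (*-monoʳ-≤ A x≤Q))
                                                          (*-monoˡ-≤ B x≤P)) ⟩
      A * Q + P * B + m * T  ≤⟨ weighted-≤ ⟩
      2 * m * (P * Q)        ≡⟨ cong (2 * m *_) x*X≡P*Q ⟨
      2 * m * (x * X)        ∎)
    (subst (T ≤_) (sym x*X≡P*Q) T≤P*Q)
    where open ≤-Reasoning

  T-bounded : T ≤ P * (m ⊓ Q) ⊎ T ≤ Q * (m ⊓ P)
  T-bounded with ≤-total Q P
  ... | inj₁ Q≤P = inj₁ (*-⊓-≤ {m} {P} {Q} (T≤m*X (*-comm Q P) Q≤P ≤-refl) T≤P*Q)
  ... | inj₂ P≤Q =
    inj₂ (*-⊓-≤ {m} {Q} {P} (T≤m*X refl ≤-refl P≤Q) (subst (T ≤_) (*-comm P Q) T≤P*Q))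

theorem1 : (n : ℕ) → 1 ≤ n → (E : BipGraph n) → (k : ℕ) → k ≤ n → n < 2 * k →
    sumFin n (λ i → sumFin n (λ j → [ ∣ degU E i - degV E j ∣ ≥? k ])) ≤ 2 * k * (n ∸ k)
theorem1 n _ E k k≤n n<2k = begin
  sumFin n (λ i → sumFin n (λ j → [ ∣ degU E i - degV E j ∣ ≥? k ]))
    ≤⟨ sumFin-mono-≤ n (λ i → sumFin-mono-≤ n (λ j → far-either i j)) ⟩
  sumFin n (λ i → sumFin n (λ j → [ degU E i ≥? degV E j + k ] + [ degV E j ≥? degU E i + k ]))
    ≡⟨ sumFin²-distrib-+ n n _ _ ⟩
  L.T + sumFin n (λ i → sumFin n (λ j → [ degV E j ≥? degU E i + k ]))
    ≡⟨ cong (L.T +_) (sumFin-comm n n _) ⟩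
  L.T + R.T
    ≤⟨ excess-pairs-≤ {P₁ = L.P} {L.Q} {R.P} {R.Q} (<⇒≤ m<k) U-split V-split
                      L.T-bounded R.T-bounded ⟩
  2 * k * m
    ∎
  where
  open ≤-Reasoning
  m : ℕ
  m = n ∸ k
  k+m≡n : k + m ≡ n
  k+m≡n = m+[n∸m]≡n k≤n
  m<k : m < k
  m<k = +-cancelˡ-< k m k (subst₂ _<_ (sym k+m≡n) (cong (k +_) (+-identityʳ k)) n<2k)
  module L = LeftExcess E k m k+m≡n
  module R = LeftExcess (flip E) k m k+m≡n
  far-either : ∀ i j → [ ∣ degU E i - degV E j ∣ ≥? k ]
                       ≤ [ degU E i ≥? degV E j + k ] + [ degV E j ≥? degU E i + k ]
  far-either i j = indicator-≤-+ (∣ degU E i - degV E j ∣ ≥? k)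
    (degU E i ≥? degV E j + k) (degV E j ≥? degU E i + k) ∣-∣≥⇒
  U-split : L.P + R.Q ≤ k + m
  U-split = subst (L.P + R.Q ≤_) (sym k+m≡n) (high+low-≤ n (degU E) m<k)
  V-split : L.Q + R.P ≤ k + m
  V-split = subst₂ _≤_ (+-comm R.P L.Q) (sym k+m≡n) (high+low-≤ n (degV E) m<k)
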